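{- For all $d \ge 1$, \[ f_0(d) = \begin{cases} 2^d & d = 1,\\ 2^{d-2} & 2 \le d \le 5,\\ 13 \cdot 2^{d-6} & 6 \le d \le 9 \text{ or } d \ge 17,\\ (191 + d) 2^{d-10} & 10 \le d \le 17,\end{cases} \qquad f_1(d) = \begin{cases} 2^{d-1} & 1 \le d \le 2,\\ 2^{d-3} & 3 \le d \le 6,\\ 15 \cdot 2^{d-7} & d \ge 7.\end{cases} \]
   Context: For $h \in \{0,1\}^d$, let $\mathcal{S}_h = \{(x_1, \dotsc, x_d) \in \mathbb{Z}^d : x_1^2 + \dotsb + x_d^2 \le d \text{ and } x_i \equiv h_i \pmod 2 \text{ for all } i\}$. Define $f_0(d) = \min |\mathcal{S}_h|$ over $h \in \{0,1\}^d$ with $h_1 + \dotsb + h_d \equiv d \pmod 2$, and $f_1(d) = \min |\mathcal{S}_h|$ over $h \in \{0,1\}^d$ with $h_1 + \dotsb + h_d \not\equiv d \pmod 2$. -}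

module Defs where

open import Data.Nat as ℕ using (ℕ; _^_)
open import Data.Nat.DivMod using (_%_)
open import Data.Integer as ℤ using (ℤ; +_)
open import Data.Integer.DivMod using (_%ℕ_)
open import Data.Bool using (Bool; true; false)
open import Data.Fin using (Fin)
open import Data.Vec using (Vec; lookup; foldr; map)
open import Data.List using (List; length)
open import Data.List.Relation.Unary.Unique.Propositional using (Unique)
open import Data.List.Membership.Propositional using (_∈_)
open import Data.Product using (Σ; _×_; ∃)
open import Function.Bundles using (_⇔_)
open import Relation.Binary.PropositionalEquality using (_≡_; _≢_)

bit : Bool → ℕ
bit false = 0
bit true  = 1

weight : ∀ {d} → Vec Bool d → ℕ
weight h = foldr _ (λ b s → bit b ℕ.+ s) 0 h

sumSq : ∀ {d} → Vec ℤ d → ℤ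
sumSq x = foldr _ (λ a s → a ℤ.* a ℤ.+ s) (+ 0) x

InS : (d : ℕ) → Vec Bool d → Vec ℤ d → Set
InS d h x = (sumSq x ℤ.≤ + d) × (∀ (i : Fin d) → lookup x i %ℕ 2 ≡ bit (lookup h i))

HasCard : ∀ {d} → (Vec ℤ d → Set) → ℕ → Set
HasCard {d} P n = Σ (List (Vec ℤ d)) λ xs →
  Unique xs × (∀ x → (x ∈ xs) ⇔ P x) × (length xs ≡ n)

IsF0 : ℕ → ℕ → Set
IsF0 d m = (Σ (Vec Bool d) λ h → (weight h % 2 ≡ d % 2) × HasCard (InS d h) m)
         × (∀ (h : Vec Bool d) → weight h % 2 ≡ d % 2 → ∀ n → HasCard (InS d h) n → m ℕ.≤ n)

IsF1 : ℕ → ℕ → Set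
IsF1 d m = (Σ (Vec Bool d) λ h → (weight h % 2 ≢ d % 2) × HasCard (InS d h) m)
         × (∀ (h : Vec Bool d) → weight h % 2 ≢ d % 2 → ∀ n → HasCard (InS d h) n → m ℕ.≤ n)

{-# OPTIONS --safe #-}
-- |S_h| depends only on the number k of odd and m = d − k of even coordinates: subtracting 1
-- from every odd square, S_h consists of the points of parity pattern h whose total excess
-- x_i² − h_i is at most m.  The minima are attained at m = 0, 2, 6, 10 for f₀ and m = 1, 3, 7
-- for f₁, where only odd coordinates ±1 (and ±3 when m = 10) and even coordinates 0, ±2 fit.
-- For the lower bound over all admissible h we count only such points; their number,
-- 2^k · Σ_s C(k, s) Σ_{j ≤ m/4 − 2s} C(m, j) 2^j, dominates the claimed minimum by direct
-- computation for small m, and for large m by induction m ↦ m + 4, along which the count grows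
-- at least 16-fold because 8 C(m, j) ≤ C(m + 4, j + 1) whenever 4j ≤ m and m ≥ 10.
module Submission where

open import Defs
open import Data.Nat using (ℕ; _+_; _*_; _∸_; _^_; _≤_)
open import Data.Product using (_×_)
open import Data.Sum using (_⊎_)
open import Relation.Binary.PropositionalEquality using (_≡_)

open import Data.Bool using (Bool; true; false; T)
open import Data.Empty using (⊥-elim)
open import Data.Integer as ℤ using (ℤ; +_; -[1+_]; +[1+_]; ∣_∣)
open import Data.Integer.DivMod using (_%ℕ_)
open import Data.Integer.Properties using (drop‿+≤+; +◃n≡+n)
open import Data.List using (List; []; _∷_; _++_; map; filter; length)
open import Data.List.Membership.Propositional using (_∈_)
open import Data.List.Membership.Propositional.Properties
  using (∈-++⁻; ∈-++⁺ˡ; ∈-++⁺ʳ; ∈-map⁺; ∈-map⁻; ∈-filter⁺; ∈-filter⁻; ∈-∃++)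
open import Data.List.Properties using (length-++; length-map)
open import Data.List.Relation.Unary.All as All using ()
open import Data.List.Relation.Unary.AllPairs using ([]; _∷_)
open import Data.List.Relation.Unary.Any using (here; there)
open import Data.List.Relation.Unary.Unique.Propositional using (Unique)
import Data.List.Relation.Unary.Unique.Propositional.Properties as Unique
open import Data.Nat
open import Data.Nat.Combinatorics using (_C_; nC1≡n) renaming (nCk+nC[k+1]≡[n+1]C[k+1] to pascal)
open import Data.Nat.DivMod using (_/_; m/n*n≤m; [m+kn]%n≡m%n)
open import Data.Nat.ListAction using (sum)
open import Data.Nat.Properties
open import Data.Nat.Tactic.RingSolver using (solve-∀)
open import Data.Product using (Σ; ∃; _,_; proj₁; proj₂)
open import Data.Sum using (inj₁; inj₂)
open import Data.Vec as Vec using (Vec; []; _∷_; replicate)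
open import Data.Vec.Relation.Binary.Pointwise.Inductive using (Pointwise; []; _∷_)
import Data.Vec.Relation.Binary.Pointwise.Extensional as Extensional
open import Function using (_∘′_)
open import Function.Bundles using (_⇔_; mk⇔; Equivalence)
open import Relation.Binary.PropositionalEquality
open import Relation.Nullary using (yes; no; ¬_)
open import Relation.Nullary.Decidable using (_×-dec_)
open import Relation.Unary using (Decidable)
open import Algebra.Properties.CommutativeSemigroup *-commutativeSemigroup
  using (x∙yz≈y∙xz; xy∙z≈y∙xz)

offset-elim : ∀ {m n} (P : ℕ → Set) → m ≤ n → (∀ k → P (k + m)) → P n
offset-elim P m≤n f = subst P (m∸n+n≡m m≤n) (f _)

m+n≡o⇒m≤o : ∀ {m n o} → m + n ≡ o → m ≤ o
m+n≡o⇒m≤o {m} {n} refl = m≤m+n m n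

absorption : ∀ n k → suc k * (suc n C suc k) ≡ suc n * (n C k)
absorption zero    zero    = refl
absorption zero    (suc k) = *-zeroʳ (2 + k)
absorption (suc n) zero    =
  trans (*-identityˡ _) (trans (nC1≡n (2 + n)) (sym (*-identityʳ (2 + n))))
absorption (suc n) (suc k) = begin
  (2 + k) * ((2 + n) C (2 + k))
    ≡⟨ cong ((2 + k) *_) (pascal (suc n) (suc k)) ⟨
  (2 + k) * (a + b)
    ≡⟨ split-factor k a b ⟩
  (1 + k) * a + a + (2 + k) * b
    ≡⟨ cong₂ (λ u v → u + a + v) (absorption n k) (absorption n (suc k)) ⟩
  (1 + n) * c₀ + a + (1 + n) * c₁
    ≡⟨ cong (λ u → (1 + n) * c₀ + u + (1 + n) * c₁) (pascal n k) ⟨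
  (1 + n) * c₀ + (c₀ + c₁) + (1 + n) * c₁
    ≡⟨ collect n c₀ c₁ ⟩
  (2 + n) * (c₀ + c₁)
    ≡⟨ cong ((2 + n) *_) (pascal n k) ⟩
  (2 + n) * a
    ∎
  where
  open ≡-Reasoning
  a = suc n C suc k
  b = suc n C (2 + k)
  c₀ = n C k
  c₁ = n C suc k
  split-factor : ∀ k a b → (2 + k) * (a + b) ≡ (1 + k) * a + a + (2 + k) * b
  split-factor = solve-∀
  collect : ∀ n x y → (1 + n) * x + (x + y) + (1 + n) * y ≡ (2 + n) * (x + y)
  collect = solve-∀

row-step : ∀ j z {n} → j + z ≡ n → suc z * (suc n C j) ≡ suc n * (n C j)
row-step zero    z refl = refl
row-step (suc j) z {n} refl = +-cancelʳ-≡ (suc n * (n C j)) _ _ (begin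
  suc z * X + suc n * (n C j)             ≡⟨ cong (λ s → suc z * X + s) (sym (absorption n j)) ⟩
  suc z * X + suc j * X                   ≡⟨ sym (*-distribʳ-+ X (suc z) (suc j)) ⟩
  (suc z + suc j) * X                     ≡⟨ cong (_* X) (+-comm (suc z) (suc j)) ⟩
  (suc j + suc z) * X                     ≡⟨ cong (λ u → suc u * X) (+-suc j z) ⟩
  suc n * X                               ≡⟨ cong (suc n *_) (sym (pascal n j)) ⟩
  suc n * (n C j + n C suc j)             ≡⟨ *-distribˡ-+ (suc n) (n C j) (n C suc j) ⟩
  suc n * (n C j) + suc n * (n C suc j)   ≡⟨ +-comm (suc n * (n C j)) _ ⟩
  suc n * (n C suc j) + suc n * (n C j)   ∎)
  where
  open ≡-Reasoning
  X = suc n C suc j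

rising : ℕ → ℕ → ℕ
rising x zero    = 1
rising x (suc i) = (suc i + x) * rising x i

rising-row : ∀ i j z → rising z i * ((i + (j + z)) C j) ≡ rising (j + z) i * ((j + z) C j)
rising-row zero    j z = refl
rising-row (suc i) j z = begin
  (suc i + z) * rising z i * (suc m C j)     ≡⟨ xy∙z≈y∙xz (suc i + z) (rising z i) _ ⟩
  rising z i * (suc (i + z) * (suc m C j))   ≡⟨ cong (rising z i *_) (row-step j (i + z) j+[i+z]≡m) ⟩
  rising z i * (suc m * (m C j))             ≡⟨ x∙yz≈y∙xz (rising z i) (suc m) _ ⟩
  suc m * (rising z i * (m C j))             ≡⟨ cong (suc m *_) (rising-row i j z) ⟩
  suc m * (rising n i * (n C j))             ≡⟨ *-assoc (suc m) (rising n i) _ ⟨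
  rising n (suc i) * (n C j)                 ∎
  where
  open ≡-Reasoning
  n = j + z
  m = i + n
  j+[i+z]≡m : j + (i + z) ≡ m
  j+[i+z]≡m = trans (sym (+-assoc j i z)) (trans (cong (_+ z) (+-comm j i)) (+-assoc i j z))

rising-nonZero : ∀ x i → NonZero (rising x i)
rising-nonZero x zero    = _
rising-nonZero x (suc i) = let instance _ = rising-nonZero x i in m*n≢0 (suc i + x) (rising x i)

shift4-identity : ∀ j z → let n = j + z in
  rising z 3 * suc j * ((4 + n) C suc j) ≡ rising n 4 * (n C j)
shift4-identity j z = begin
  rising z 3 * suc j * (suc (3 + n) C suc j)   ≡⟨ *-assoc (rising z 3) (suc j) _ ⟩
  rising z 3 * (suc j * (suc (3 + n) C suc j)) ≡⟨ cong (rising z 3 *_) (absorption (3 + n) j) ⟩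
  rising z 3 * ((4 + n) * ((3 + n) C j))       ≡⟨ x∙yz≈y∙xz (rising z 3) (4 + n) ((3 + n) C j) ⟩
  (4 + n) * (rising z 3 * ((3 + n) C j))       ≡⟨ cong ((4 + n) *_) (rising-row 3 j z) ⟩
  (4 + n) * (rising n 3 * (n C j))             ≡⟨ *-assoc (4 + n) (rising n 3) _ ⟨
  rising n 4 * (n C j)                         ∎
  where
  open ≡-Reasoning
  n = j + z

-- In each case the difference of the two sides is an explicit polynomial with nonnegative
-- coefficients.  Numerals are kept to the right of variables (b + 10, a + 3, t + 3 * j): type
-- checking unfolds products whose first factor is headed by a numeral.
rising-bound : ∀ j z → 3 * j ≤ z → 10 ≤ j + z → 8 * (rising z 3 * suc j) ≤ rising (j + z) 4
rising-bound 0 z _ 10≤z =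
  offset-elim (λ z → 8 * (rising z 3 * 1) ≤ rising z 4) 10≤z (λ b → m+n≡o⇒m≤o (certificate b))
  where
  certificate : ∀ b → let z = b + 10; n = 0 + z in
    8 * ((3 + z) * ((2 + z) * ((1 + z) * 1)) * 1) + (b + 11) * (b + 12) * (b + 13) * (b + 6) ≡
    (4 + n) * ((3 + n) * ((2 + n) * ((1 + n) * 1)))
  certificate = solve-∀
rising-bound 1 z _ (s≤s 9≤z) =
  offset-elim (λ z → 8 * (rising z 3 * 2) ≤ rising (1 + z) 4) 9≤z (λ b → m+n≡o⇒m≤o (certificate b))
  where
  certificate : ∀ b → let z = b + 9; n = 1 + z in
    8 * ((3 + z) * ((2 + z) * ((1 + z) * 1)) * 2) + (b + 11) * (b + 12) * (b * b + 11 * b + 22) ≡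
    (4 + n) * ((3 + n) * ((2 + n) * ((1 + n) * 1)))
  certificate = solve-∀
rising-bound 2 z _ (s≤s (s≤s 8≤z)) =
  offset-elim (λ z → 8 * (rising z 3 * 3) ≤ rising (2 + z) 4) 8≤z (λ b → m+n≡o⇒m≤o (certificate b))
  where
  certificate : ∀ b → let z = b + 8; n = 2 + z in
    8 * ((3 + z) * ((2 + z) * ((1 + z) * 1)) * 3) + (b + 11) * (b * b * b + 15 * b * b + 50 * b + 24) ≡
    (4 + n) * ((3 + n) * ((2 + n) * ((1 + n) * 1)))
  certificate = solve-∀
rising-bound j@(suc (suc (suc _))) z 3j≤z _ =
  offset-elim (λ j → ∀ z → 3 * j ≤ z → 8 * (rising z 3 * suc j) ≤ rising (j + z) 4)
    (s≤s (s≤s (s≤s z≤n)))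
    (λ a z 3j≤z → offset-elim (λ z → 8 * (rising z 3 * suc (a + 3)) ≤ rising (a + 3 + z) 4) 3j≤z
       (λ t → m+n≡o⇒m≤o (certificate a t)))
    z 3j≤z
  where
  certificate : ∀ a t → let j = a + 3; z = t + 3 * j; n = j + z in
    8 * ((3 + z) * ((2 + z) * ((1 + z) * 1)) * (1 + j)) +
    (40 * a * a * a * a + 40 * a * a * a * t + 24 * a * a * t * t + 8 * a * t * t * t + t * t * t * t
     + 472 * a * a * a + 336 * a * a * t + 144 * a * t * t + 26 * t * t * t
     + 1952 * a * a + 840 * a * t + 203 * t * t + 3176 * a + 538 * t + 1440) ≡
    (4 + n) * ((3 + n) * ((2 + n) * ((1 + n) * 1)))
  certificate = solve-∀

binomial-growth : ∀ {m j} → 10 ≤ m → 4 * j ≤ m → 8 * (m C j) ≤ (4 + m) C suc j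
binomial-growth {m} {j} 10≤m 4j≤m =
  subst (λ m → 8 * (m C j) ≤ (4 + m) C suc j) (m+[n∸m]≡n j≤m) (cancel (begin
    Q * (8 * (n C j))         ≡⟨ x∙yz≈y∙xz Q 8 (n C j) ⟩
    8 * (Q * (n C j))         ≡⟨ *-assoc 8 Q (n C j) ⟨
    8 * Q * (n C j)           ≤⟨ *-monoˡ-≤ (n C j) (rising-bound j z 3j≤z 10≤n) ⟩
    rising n 4 * (n C j)      ≡⟨ shift4-identity j z ⟨
    Q * ((4 + n) C suc j)     ∎))
  where
  open ≤-Reasoning
  j≤m : j ≤ m
  j≤m = ≤-trans (m≤m+n j (3 * j)) 4j≤m
  z = m ∸ j
  n = j + z
  Q = rising z 3 * suc j
  instance _ = rising-nonZero z 3
  cancel : ∀ {x y} → Q * x ≤ Q * y → x ≤ y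
  cancel = *-cancelˡ-≤ Q {{m*n≢0 (rising z 3) (suc j)}}
  3j≤z : 3 * j ≤ z
  3j≤z = +-cancelˡ-≤ j (3 * j) z (subst (4 * j ≤_) (sym (m+[n∸m]≡n j≤m)) 4j≤m)
  10≤n : 10 ≤ n
  10≤n = subst (10 ≤_) (sym (m+[n∸m]≡n j≤m)) 10≤m

-- The number of vectors in {0, ±2}^m with at most r nonzero entries.
sparse : ℕ → ℕ → ℕ
sparse m zero    = 1
sparse m (suc r) = sparse m r + (m C suc r) * 2 ^ suc r

sparse-suc : ∀ m r → sparse (suc m) (suc r) ≡ sparse m (suc r) + 2 * sparse m r
sparse-suc m zero = begin
  1 + (suc m C 1) * 2              ≡⟨ cong (λ c → 1 + c * 2) (pascal m 0) ⟨
  1 + (1 + m C 1) * 2              ≡⟨ rearrange (m C 1) ⟩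
  1 + (m C 1) * 2 + 2 * 1          ∎
  where
  open ≡-Reasoning
  rearrange : ∀ c → 1 + (1 + c) * 2 ≡ 1 + c * 2 + 2 * 1
  rearrange = solve-∀
sparse-suc m (suc r) = begin
  sparse (suc m) (suc r) + (suc m C (2 + r)) * 2 ^ (2 + r)
    ≡⟨ cong₂ (λ s c → s + c * 2 ^ (2 + r)) (sym (sparse-suc m r)) (pascal m (suc r)) ⟨
  sparse m (suc r) + 2 * sparse m r + (m C suc r + m C (2 + r)) * (2 * 2 ^ suc r)
    ≡⟨ rearrange (sparse m (suc r)) (sparse m r) (m C suc r) (m C (2 + r)) (2 ^ suc r) ⟩
  sparse m (suc r) + (m C (2 + r)) * (2 * 2 ^ suc r) + 2 * (sparse m r + (m C suc r) * 2 ^ suc r)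
    ∎
  where
  open ≡-Reasoning
  rearrange : ∀ s₁ s₀ c₁ c₂ p →
              s₁ + 2 * s₀ + (c₁ + c₂) * (2 * p) ≡ s₁ + c₂ * (2 * p) + 2 * (s₀ + c₁ * p)
  rearrange = solve-∀

sparse-zero : ∀ r → sparse 0 r ≡ 1
sparse-zero zero    = refl
sparse-zero (suc r) = trans (+-identityʳ _) (sparse-zero r)

sparse-shift4 : ∀ {m} r → 10 ≤ m → 4 * r ≤ m → 16 * sparse m r ≤ sparse (4 + m) (suc r)
sparse-shift4 {m} zero 10≤m _ = begin
  16                      ≤⟨ ≤-trans (m≤m+n 16 13) (s≤s (*-monoˡ-≤ 2 (+-monoʳ-≤ 4 10≤m))) ⟩
  1 + (4 + m) * 2         ≡⟨ cong (λ c → 1 + c * 2) (nC1≡n (4 + m)) ⟨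
  1 + ((4 + m) C 1) * 2   ∎
  where open ≤-Reasoning
sparse-shift4 {m} (suc r) 10≤m 4r≤m = begin
  16 * (sparse m r + (m C suc r) * 2 ^ suc r)
    ≡⟨ *-distribˡ-+ 16 (sparse m r) _ ⟩
  16 * sparse m r + 16 * ((m C suc r) * 2 ^ suc r)
    ≤⟨ +-mono-≤ (sparse-shift4 r 10≤m (≤-trans (*-monoʳ-≤ 4 (n≤1+n r)) 4r≤m))
                (≤-reflexive (regroup (m C suc r) (2 ^ suc r))) ⟩
  sparse (4 + m) (suc r) + 8 * (m C suc r) * 2 ^ (2 + r)
    ≤⟨ +-monoʳ-≤ _ (*-monoˡ-≤ (2 ^ (2 + r)) (binomial-growth {m} {suc r} 10≤m 4r≤m)) ⟩
  sparse (4 + m) (suc r) + ((4 + m) C (2 + r)) * 2 ^ (2 + r)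
    ∎
  where
  open ≤-Reasoning
  regroup : ∀ c p → 16 * (c * p) ≡ 8 * c * (2 * p)
  regroup = solve-∀

-- Points with k odd coordinates in {1, 3} and m even ones in {0, ±2} whose total excess is at
-- most 4r: a ±2 costs 4 and a 3 costs 8.  Signs of odd coordinates are not counted.
smallCount : ℕ → ℕ → ℕ → ℕ
smallCount zero    m r             = sparse m r
smallCount (suc k) m (suc (suc r)) = smallCount k m (2 + r) + smallCount k m r
smallCount (suc k) m r             = smallCount k m r

smallCount-zero : ∀ k m → smallCount k m 0 ≡ 1
smallCount-zero zero    m = refl
smallCount-zero (suc k) m = smallCount-zero k m

smallCount-suc : ∀ k m r →
                 smallCount k (suc m) (suc r) ≡ smallCount k m (suc r) + 2 * smallCount k m r
smallCount-suc zero    m r             = sparse-suc m r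
smallCount-suc (suc k) m zero          = smallCount-suc k m zero
smallCount-suc (suc k) m (suc zero)    = begin
  G (suc m) 2 + G (suc m) 0      ≡⟨ cong₂ _+_ (smallCount-suc k m 1) (smallCount-zero k (suc m)) ⟩
  G m 2 + 2 * G m 1 + 1          ≡⟨ cong (λ u → G m 2 + 2 * G m 1 + u) (smallCount-zero k m) ⟨
  G m 2 + 2 * G m 1 + G m 0      ≡⟨ swap (G m 2) (G m 1) (G m 0) ⟩
  G m 2 + G m 0 + 2 * G m 1      ∎
  where
  open ≡-Reasoning
  G = smallCount k
  swap : ∀ x y z → x + 2 * y + z ≡ x + z + 2 * y
  swap = solve-∀
smallCount-suc (suc k) m (suc (suc r)) = begin
  G (suc m) (3 + r) + G (suc m) (suc r)
    ≡⟨ cong₂ _+_ (smallCount-suc k m (2 + r)) (smallCount-suc k m r) ⟩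
  (G m (3 + r) + 2 * G m (2 + r)) + (G m (suc r) + 2 * G m r)
    ≡⟨ regroup (G m (3 + r)) (G m (2 + r)) (G m (suc r)) (G m r) ⟩
  (G m (3 + r) + G m (suc r)) + 2 * (G m (2 + r) + G m r)
    ∎
  where
  open ≡-Reasoning
  G = smallCount k
  regroup : ∀ a b c d → (a + 2 * b) + (c + 2 * d) ≡ (a + c) + 2 * (b + d)
  regroup = solve-∀

sparse≤smallCount : ∀ k m r → sparse m r ≤ smallCount k m r
sparse≤smallCount zero    m r             = ≤-refl
sparse≤smallCount (suc k) m zero          = sparse≤smallCount k m zero
sparse≤smallCount (suc k) m (suc zero)    = sparse≤smallCount k m 1
sparse≤smallCount (suc k) m (suc (suc r)) = ≤-trans (sparse≤smallCount k m (2 + r)) (m≤m+n _ _)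

smallCount-10-2 : ∀ k → smallCount k 10 2 ≡ k + 201
smallCount-10-2 zero    = refl
smallCount-10-2 (suc k) =
  trans (cong₂ _+_ (smallCount-10-2 k) (smallCount-zero k 10)) (+-comm (k + 201) 1)

smallCount-14-3 : ∀ k → 29 * k + 3305 ≤ smallCount k 14 3
smallCount-14-3 zero    = ≤-refl
smallCount-14-3 (suc k) = begin
  29 * suc k + 3305                  ≡⟨ step k ⟩
  (29 * k + 3305) + 29               ≤⟨ +-mono-≤ (smallCount-14-3 k) (sparse≤smallCount k 14 1) ⟩
  smallCount k 14 3 + smallCount k 14 1 ∎
  where
  open ≤-Reasoning
  step : ∀ k → 29 * suc k + 3305 ≡ (29 * k + 3305) + 29
  step = solve-∀

-- c · 2^(k + m ∸ a) ≤ 2^k · count r with the factor 2^k (signs of the odd coordinates) divided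
-- out, see rescale; the budget r is at most m / 4 so that the counted points lie in S_h.
record Dominates (c a m : ℕ) (count : ℕ → ℕ) : Set where
  constructor dominates
  field
    budget  : ℕ
    budget≤ : 4 * budget ≤ m
    bound   : c * 2 ^ m ≤ 2 ^ a * count budget

Dominates-mono : ∀ {c a m f g} → (∀ r → f r ≤ g r) → Dominates c a m f → Dominates c a m g
Dominates-mono {a = a} f≤g (dominates r 4r≤m bound) =
  dominates r 4r≤m (≤-trans bound (*-monoʳ-≤ (2 ^ a) (f≤g r)))

Dominates-weaken : ∀ {c c′ a m f} → c′ ≤ c → Dominates c a m f → Dominates c′ a m f
Dominates-weaken {m = m} c′≤c (dominates r 4r≤m bound) =
  dominates r 4r≤m (≤-trans (*-monoˡ-≤ (2 ^ m) c′≤c) bound)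

by-computation : ∀ {c a m} → T (c * 2 ^ m ≤ᵇ 2 ^ a * sparse m (m / 4)) → Dominates c a m (sparse m)
by-computation {c} {a} {m} ok =
  dominates (m / 4) (subst (_≤ m) (*-comm (m / 4) 4) (m/n*n≤m m 4)) (≤ᵇ⇒≤ (c * 2 ^ m) _ ok)

Dominates-shift4 : ∀ {c a m} → 10 ≤ m →
                   Dominates c a m (sparse m) → Dominates c a (4 + m) (sparse (4 + m))
Dominates-shift4 {c} {a} {m} 10≤m (dominates r 4r≤m bound) =
  dominates (suc r) (subst (_≤ 4 + m) (sym (*-suc 4 r)) (+-monoʳ-≤ 4 4r≤m)) (begin
    c * 2 ^ (4 + m)                 ≡⟨ regroup c (2 ^ m) ⟩
    16 * (c * 2 ^ m)                ≤⟨ *-monoʳ-≤ 16 bound ⟩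
    16 * (2 ^ a * sparse m r)       ≡⟨ x∙yz≈y∙xz 16 (2 ^ a) (sparse m r) ⟩
    2 ^ a * (16 * sparse m r)       ≤⟨ *-monoʳ-≤ (2 ^ a) (sparse-shift4 r 10≤m 4r≤m) ⟩
    2 ^ a * sparse (4 + m) (suc r)  ∎)
  where
  open ≤-Reasoning
  regroup : ∀ c p → c * (2 * (2 * (2 * (2 * p)))) ≡ 16 * (c * p)
  regroup = solve-∀

dominates-13-6-tail : ∀ i → Dominates 13 6 (18 + i * 2) (sparse (18 + i * 2))
dominates-13-6-tail 0             = by-computation _
dominates-13-6-tail 1             = by-computation _
dominates-13-6-tail (suc (suc i)) =
  Dominates-shift4 (≤-trans (m≤m+n 10 8) (m≤m+n 18 (i * 2))) (dominates-13-6-tail i)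

dominates-15-7-tail : ∀ i → Dominates 15 7 (11 + i * 2) (sparse (11 + i * 2))
dominates-15-7-tail 0             = by-computation _
dominates-15-7-tail 1             = by-computation _
dominates-15-7-tail (suc (suc i)) =
  Dominates-shift4 (≤-trans (m≤m+n 10 1) (m≤m+n 11 (i * 2))) (dominates-15-7-tail i)

HasParity : ℤ → Bool → Set
HasParity x p = x %ℕ 2 ≡ bit p

excess : Bool → ℤ → ℕ
excess p x = ∣ x ∣ * ∣ x ∣ ∸ bit p

totalExcess : ∀ {n} → Vec Bool n → Vec ℤ n → ℕ
totalExcess h x = Vec.sum (Vec.zipWith excess h x)

Admissible : Bool → ℕ → ℤ → Set
Admissible p e x = HasParity x p × excess p x ≤ e

admissible? : ∀ p e → Decidable (Admissible p e)
admissible? p e x = (x %ℕ 2 ≟ bit p) ×-dec (excess p x ≤? e)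

signedFrom : ℕ → ℕ → List ℤ
signedFrom s zero    = []
signedFrom s (suc n) = +[1+ s ] ∷ -[1+ s ] ∷ signedFrom (suc s) n

ball : ℕ → List ℤ
ball N = + 0 ∷ signedFrom 0 N

candidates : Bool → ℕ → List ℤ
candidates p e = filter (admissible? p e) (ball (suc e))

extend : ∀ {n} → List ℤ → (ℤ → List (Vec ℤ n)) → List (Vec ℤ (suc n))
extend []       f = []
extend (c ∷ cs) f = map (c ∷_) (f c) ++ extend cs f

-- Candidates are listed as 0, ±1, ±2, …, so that for a symbolic budget the first admissible
-- ones are computed definitionally; points-true-≥-8 and points-false-≥-4 rely on this.
points : ∀ {n} → Vec Bool n → ℕ → List (Vec ℤ n)
points []      e = [] ∷ []
points (p ∷ h) e = extend (candidates p e) (λ c → points h (e ∸ excess p c))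

signedFrom-abs : ∀ s n {x} → x ∈ signedFrom s n → suc s ≤ ∣ x ∣
signedFrom-abs s (suc n) (here refl)         = ≤-refl
signedFrom-abs s (suc n) (there (here refl)) = ≤-refl
signedFrom-abs s (suc n) (there (there x∈))  = <⇒≤ (signedFrom-abs (suc s) n x∈)

signedFrom-complete : ∀ s n k → s ≤ k → k < s + n →
                      +[1+ k ] ∈ signedFrom s n × -[1+ k ] ∈ signedFrom s n
signedFrom-complete s zero    k s≤k k<s+0 =
  ⊥-elim (<-irrefl refl (≤-trans (subst (k <_) (+-identityʳ s) k<s+0) s≤k))
signedFrom-complete s (suc n) k s≤k k<s+n with s ≟ k
... | yes refl = here refl , there (here refl)
... | no s≢k   =
  let +∈ , -∈ = signedFrom-complete (suc s) n k (≤∧≢⇒< s≤k s≢k) (subst (k <_) (+-suc s n) k<s+n) in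
  there (there +∈) , there (there -∈)

ball-complete : ∀ N x → ∣ x ∣ ≤ N → x ∈ ball N
ball-complete N (+ zero)  _   = here refl
ball-complete N +[1+ k ]  k<N = there (proj₁ (signedFrom-complete 0 N k z≤n k<N))
ball-complete N -[1+ k ]  k<N = there (proj₂ (signedFrom-complete 0 N k z≤n k<N))

abs-<⇒≢ : ∀ {x y : ℤ} → ∣ x ∣ < ∣ y ∣ → x ≢ y
abs-<⇒≢ lt refl = <-irrefl refl lt

signedFrom-unique : ∀ s n → Unique (signedFrom s n)
signedFrom-unique s zero    = []
signedFrom-unique s (suc n) =
  ((λ ()) All.∷ All.tabulate (abs-<⇒≢ ∘′ signedFrom-abs (suc s) n))
  ∷ All.tabulate (abs-<⇒≢ ∘′ signedFrom-abs (suc s) n)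
  ∷ signedFrom-unique (suc s) n

ball-unique : ∀ N → Unique (ball N)
ball-unique N = All.tabulate (λ y∈ → abs-<⇒≢ (signedFrom-abs 0 N y∈)) ∷ signedFrom-unique 0 N

module _ {n : ℕ} where

  ∈-extend⁻ : ∀ cs (f : ℤ → List (Vec ℤ n)) {v} → v ∈ extend cs f →
              ∃ λ c → ∃ λ t → c ∈ cs × v ≡ c ∷ t × t ∈ f c
  ∈-extend⁻ (c ∷ cs) f v∈ with ∈-++⁻ (map (c ∷_) (f c)) v∈
  ... | inj₁ v∈c with ∈-map⁻ (c ∷_) v∈c
  ...   | t , t∈ , refl = c , t , here refl , refl , t∈
  ∈-extend⁻ (c ∷ cs) f v∈ | inj₂ v∈cs =
    let c′ , t , c′∈ , eq , t∈ = ∈-extend⁻ cs f v∈cs in c′ , t , there c′∈ , eq , t∈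

  ∈-extend⁺ : ∀ {cs} (f : ℤ → List (Vec ℤ n)) {c t} → c ∈ cs → t ∈ f c →
              (c ∷ t) ∈ extend cs f
  ∈-extend⁺ f (here refl) t∈          = ∈-++⁺ˡ (∈-map⁺ (_ ∷_) t∈)
  ∈-extend⁺ {c′ ∷ _} f (there c∈) t∈ = ∈-++⁺ʳ (map (c′ ∷_) (f c′)) (∈-extend⁺ f c∈ t∈)

  extend-unique : ∀ {cs} (f : ℤ → List (Vec ℤ n)) →
                  Unique cs → (∀ c → Unique (f c)) → Unique (extend cs f)
  extend-unique f []                   _   = []
  extend-unique {c ∷ cs} f (c∉ ∷ !cs) !f =
    Unique.++⁺ (Unique.map⁺ ∷-injectiveʳ (!f c)) (extend-unique f !cs !f) disjoint
    where
    ∷-injectiveʳ : ∀ {t u : Vec ℤ n} → _≡_ {A = Vec ℤ (suc n)} (c ∷ t) (c ∷ u) → t ≡ u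
    ∷-injectiveʳ refl = refl
    disjoint : ∀ {v} → ¬ (v ∈ map (c ∷_) (f c) × v ∈ extend cs f)
    disjoint (v∈c , v∈cs) with ∈-map⁻ (c ∷_) v∈c | ∈-extend⁻ cs f v∈cs
    ... | _ , _ , refl | _ , _ , c∈cs , refl , _ = All.lookup c∉ c∈cs refl

  length-extend : ∀ cs (f : ℤ → List (Vec ℤ n)) →
                  length (extend cs f) ≡ sum (map (λ c → length (f c)) cs)
  length-extend []       f = refl
  length-extend (c ∷ cs) f = begin
    length (map (c ∷_) (f c) ++ extend cs f)
      ≡⟨ length-++ (map (c ∷_) (f c)) ⟩
    length (map (c ∷_) (f c)) + length (extend cs f)
      ≡⟨ cong₂ _+_ (length-map (c ∷_) (f c)) (length-extend cs f) ⟩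
    length (f c) + sum (map (λ c → length (f c)) cs)
      ∎
    where open ≡-Reasoning

points-unique : ∀ {n} (h : Vec Bool n) e → Unique (points h e)
points-unique []      e = All.[] ∷ []
points-unique (p ∷ h) e =
  extend-unique _ (Unique.filter⁺ (admissible? p e) (ball-unique (suc e))) (λ c → points-unique h _)

∣x∣≤∣x∣*∣x∣ : ∀ x → ∣ x ∣ ≤ ∣ x ∣ * ∣ x ∣
∣x∣≤∣x∣*∣x∣ x with ∣ x ∣
... | zero  = z≤n
... | suc a = m≤m*n (suc a) (suc a)

bit≤1 : ∀ p → bit p ≤ 1
bit≤1 false = z≤n
bit≤1 true  = ≤-refl

∈-points : ∀ {n} (h : Vec Bool n) e x →
           x ∈ points h e ⇔ (Pointwise HasParity x h × totalExcess h x ≤ e)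
∈-points []      e []      = mk⇔ (λ _ → [] , z≤n) (λ _ → here refl)
∈-points (p ∷ h) e (c ∷ t) = mk⇔ to from
  where
  Spec : Set
  Spec = Pointwise HasParity (c ∷ t) (p ∷ h) × excess p c + totalExcess h t ≤ e
  to : (c ∷ t) ∈ points (p ∷ h) e → Spec
  to ct∈ with ∈-extend⁻ (candidates p e) _ ct∈
  ... | _ , _ , c∈ , refl , t∈ =
    let _ , parity , excess≤e = ∈-filter⁻ (admissible? p e) {xs = ball (suc e)} c∈
        pointwise , rest≤ = Equivalence.to (∈-points h (e ∸ excess p c) t) t∈
    in parity ∷ pointwise ,
       ≤-trans (+-monoʳ-≤ (excess p c) rest≤) (≤-reflexive (m+[n∸m]≡n excess≤e))
  from : Spec → (c ∷ t) ∈ points (p ∷ h) e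
  from (parity ∷ pointwise , le) = ∈-extend⁺ _ c∈ t∈
    where
    excess≤e : excess p c ≤ e
    excess≤e = m+n≤o⇒m≤o (excess p c) le
    |c|≤ : ∣ c ∣ ≤ suc e
    |c|≤ = ≤-trans (∣x∣≤∣x∣*∣x∣ c)
             (≤-trans (m≤n+m∸n _ (bit p)) (+-mono-≤ (bit≤1 p) excess≤e))
    c∈ : c ∈ candidates p e
    c∈ = ∈-filter⁺ (admissible? p e) (ball-complete (suc e) c |c|≤) (parity , excess≤e)
    t∈ : t ∈ points h (e ∸ excess p c)
    t∈ = Equivalence.from (∈-points h (e ∸ excess p c) t)
           (pointwise , m+n≤o⇒m≤o∸n (totalExcess h t) (subst (_≤ e) (+-comm (excess p c) _) le))

square-abs : ∀ x → x ℤ.* x ≡ + (∣ x ∣ * ∣ x ∣)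
square-abs (+ n)    = +◃n≡+n (n * n)
square-abs -[1+ n ] = +◃n≡+n (suc n * suc n)

square-split : ∀ p x → HasParity x p → ∣ x ∣ * ∣ x ∣ ≡ excess p x + bit p
square-split false x         _ = sym (+-identityʳ _)
square-split true  (+ zero)  ()
square-split true  +[1+ n ]  _ = sym (m∸n+n≡m (s≤s z≤n))
square-split true  -[1+ n ]  _ = sym (m∸n+n≡m (s≤s z≤n))

sumSq-≡ : ∀ {n} {h : Vec Bool n} {x} → Pointwise HasParity x h →
          sumSq x ≡ + (totalExcess h x + weight h)
sumSq-≡ []                                  = refl
sumSq-≡ {h = p ∷ h} {c ∷ t} (parity ∷ rest) = begin
  c ℤ.* c ℤ.+ sumSq t                 ≡⟨ cong₂ ℤ._+_ (square-abs c) (sumSq-≡ rest) ⟩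
  + (∣ c ∣ * ∣ c ∣ + (E + w))           ≡⟨ cong (λ s → + (s + (E + w))) (square-split p c parity) ⟩
  + (excess p c + bit p + (E + w))    ≡⟨ cong +_ (shuffle (excess p c) (bit p) E w) ⟩
  + (excess p c + E + (bit p + w))    ∎
  where
  open ≡-Reasoning
  E = totalExcess h t
  w = weight h
  shuffle : ∀ a b c d → a + b + (c + d) ≡ a + c + (b + d)
  shuffle = solve-∀

weight≤length : ∀ {n} (h : Vec Bool n) → weight h ≤ n
weight≤length []          = z≤n
weight≤length (true ∷ h)  = s≤s (weight≤length h)
weight≤length (false ∷ h) = m≤n⇒m≤1+n (weight≤length h)

InS⇔ : ∀ d (h : Vec Bool d) x →
       InS d h x ⇔ (Pointwise HasParity x h × totalExcess h x ≤ d ∸ weight h)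
InS⇔ d h x = mk⇔ to from
  where
  to : InS d h x → Pointwise HasParity x h × totalExcess h x ≤ d ∸ weight h
  to (sumSq≤d , parity) =
    pointwise , m+n≤o⇒m≤o∸n _ (drop‿+≤+ (subst (ℤ._≤ + d) (sumSq-≡ pointwise) sumSq≤d))
    where
    pointwise : Pointwise HasParity x h
    pointwise = Extensional.extensional⇒inductive (Extensional.ext parity)
  from : Pointwise HasParity x h × totalExcess h x ≤ d ∸ weight h → InS d h x
  from (pointwise , le) =
    subst (ℤ._≤ + d) (sym (sumSq-≡ pointwise)) (ℤ.+≤+ (m≤o∸n⇒m+n≤o _ (weight≤length h) le)) ,
    Extensional.Pointwise.app (Extensional.inductive⇒extensional pointwise)

size : ∀ {d} → Vec Bool d → ℕ
size {d} h = length (points h (d ∸ weight h))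

∈-points⇔InS : ∀ {d} (h : Vec Bool d) x → x ∈ points h (d ∸ weight h) ⇔ InS d h x
∈-points⇔InS {d} h x = mk⇔
  (Equivalence.from (InS⇔ d h x) ∘′ Equivalence.to (∈-points h _ x))
  (Equivalence.from (∈-points h _ x) ∘′ Equivalence.to (InS⇔ d h x))

size-card : ∀ {d} (h : Vec Bool d) → HasCard (InS d h) (size h)
size-card h = points h _ , points-unique h _ , ∈-points⇔InS h , refl

unique-⊆⇒length≤ : ∀ {A : Set} {xs ys : List A} →
                   Unique xs → (∀ {x} → x ∈ xs → x ∈ ys) → length xs ≤ length ys
unique-⊆⇒length≤ {xs = []}     _            _  = z≤n
unique-⊆⇒length≤ {xs = x ∷ xs} (x∉ ∷ !xs) xs⊆ with ∈-∃++ (xs⊆ (here refl))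
... | ys₁ , ys₂ , refl = begin
  suc (length xs)                 ≤⟨ s≤s (unique-⊆⇒length≤ !xs xs⊆ys₁ys₂) ⟩
  suc (length (ys₁ ++ ys₂))       ≡⟨ cong suc (length-++ ys₁) ⟩
  suc (length ys₁ + length ys₂)   ≡⟨ +-suc (length ys₁) (length ys₂) ⟨
  length ys₁ + length (x ∷ ys₂)   ≡⟨ length-++ ys₁ ⟨
  length (ys₁ ++ x ∷ ys₂)         ∎
  where
  open ≤-Reasoning
  xs⊆ys₁ys₂ : ∀ {y} → y ∈ xs → y ∈ ys₁ ++ ys₂
  xs⊆ys₁ys₂ y∈ with ∈-++⁻ ys₁ (xs⊆ (there y∈))
  ... | inj₁ y∈ys₁         = ∈-++⁺ˡ y∈ys₁
  ... | inj₂ (here refl)   = ⊥-elim (All.lookup x∉ y∈ refl)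
  ... | inj₂ (there y∈ys₂) = ∈-++⁺ʳ ys₁ y∈ys₂

size-minimal : ∀ {d} (h : Vec Bool d) {n} → HasCard (InS d h) n → size h ≤ n
size-minimal h (xs , _ , xs⇔ , refl) =
  unique-⊆⇒length≤ (points-unique h _)
    (λ {x} x∈ → Equivalence.from (xs⇔ x) (Equivalence.to (∈-points⇔InS h x) x∈))

MinimalCard : (d : ℕ) → (Vec Bool d → Set) → ℕ → Set
MinimalCard d Adm m =
  (Σ (Vec Bool d) λ h → Adm h × HasCard (InS d h) m) ×
  (∀ h → Adm h → ∀ n → HasCard (InS d h) n → m ≤ n)

minimalCard-intro : ∀ {d Adm m} (h₀ : Vec Bool d) → Adm h₀ → size h₀ ≡ m →
                    (∀ h → Adm h → m ≤ size h) → MinimalCard d Adm m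
minimalCard-intro {d} {Adm} h₀ adm₀ size≡ lower =
  (h₀ , adm₀ , subst (HasCard (InS d h₀)) size≡ (size-card h₀)) ,
  λ h adm n card → ≤-trans (lower h adm) (size-minimal h card)

evens : ∀ {n} → Vec Bool n → ℕ
evens []          = 0
evens (true ∷ h)  = evens h
evens (false ∷ h) = suc (evens h)

weight+evens : ∀ {n} (h : Vec Bool n) → weight h + evens h ≡ n
weight+evens []          = refl
weight+evens (true ∷ h)  = cong suc (weight+evens h)
weight+evens (false ∷ h) = trans (+-suc (weight h) (evens h)) (cong suc (weight+evens h))

length-points-∷ : ∀ {n} p (h : Vec Bool n) e → length (points (p ∷ h) e) ≡
                  sum (map (λ c → length (points h (e ∸ excess p c))) (candidates p e))
length-points-∷ p h e = length-extend (candidates p e) (λ c → points h (e ∸ excess p c))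

module _ {n} (h : Vec Bool n) where

  points-true-≥ : ∀ e {x} → x ≤ length (points h e) → 2 * x ≤ length (points (true ∷ h) e)
  points-true-≥ e {x} x≤ = subst (2 * x ≤_) (sym (length-points-∷ true h e))
    (+-mono-≤ x≤ (+-mono-≤ x≤ z≤n))

  points-true-≥-8 : ∀ e {x y} → x ≤ length (points h (8 + e)) → y ≤ length (points h e) →
                    2 * (x + y) ≤ length (points (true ∷ h) (8 + e))
  points-true-≥-8 e {x} {y} x≤ y≤ = subst (2 * (x + y) ≤_) (sym (length-points-∷ true h (8 + e)))
    (≤-trans (≤-reflexive (spread x y)) (+-mono-≤ x≤ (+-mono-≤ x≤ (+-mono-≤ y≤ (+-mono-≤ y≤ z≤n)))))
    where
    spread : ∀ x y → 2 * (x + y) ≡ x + (x + (y + (y + 0)))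
    spread = solve-∀

  points-false-≥ : ∀ e {x} → x ≤ length (points h e) → x ≤ length (points (false ∷ h) e)
  points-false-≥ e {x} x≤ = subst (x ≤_) (sym (length-points-∷ false h e)) (≤-trans x≤ (m≤m+n _ _))

  points-false-≥-4 : ∀ e {x y} → x ≤ length (points h (4 + e)) → y ≤ length (points h e) →
                     x + 2 * y ≤ length (points (false ∷ h) (4 + e))
  points-false-≥-4 e {x} {y} x≤ y≤ = subst (x + 2 * y ≤_) (sym (length-points-∷ false h (4 + e)))
    (+-mono-≤ x≤ (+-mono-≤ y≤ (+-mono-≤ y≤ z≤n)))

budget-split : ∀ i {r e} → 4 * (i + r) ≤ e → ∃ λ e′ → e ≡ 4 * i + e′ × 4 * r ≤ e′
budget-split i {r} {e} le = e ∸ 4 * i , sym (m+[n∸m]≡n (m+n≤o⇒m≤o (4 * i) le′)) ,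
  m+n≤o⇒m≤o∸n (4 * r) (subst (_≤ e) (+-comm (4 * i) (4 * r)) le′)
  where
  le′ : 4 * i + 4 * r ≤ e
  le′ = subst (_≤ e) (*-distribˡ-+ 4 i r) le

smallCount≤points : ∀ {n} (h : Vec Bool n) e r → 4 * r ≤ e →
                    2 ^ weight h * smallCount (weight h) (evens h) r ≤ length (points h e)
smallCount≤points []          e r _   = ≤-reflexive (trans (+-identityʳ _) (sparse-zero r))
smallCount≤points (true ∷ h)  e 0 _   = ≤-trans (≤-reflexive (*-assoc 2 (2 ^ weight h) _))
  (points-true-≥ h e (smallCount≤points h e 0 z≤n))
smallCount≤points (true ∷ h)  e 1 4≤e = ≤-trans (≤-reflexive (*-assoc 2 (2 ^ weight h) _))
  (points-true-≥ h e (smallCount≤points h e 1 4≤e))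
smallCount≤points (true ∷ h)  e (suc (suc r)) 4r≤e with budget-split 2 4r≤e
... | e′ , refl , 4r≤e′ = begin
  2 * P * (G (2 + r) + G r)            ≡⟨ distrib P (G (2 + r)) (G r) ⟩
  2 * (P * G (2 + r) + P * G r)        ≤⟨ points-true-≥-8 h e′ (smallCount≤points h (8 + e′) (2 + r) 4r≤e)
                                                              (smallCount≤points h e′ r 4r≤e′) ⟩
  length (points (true ∷ h) (8 + e′))  ∎
  where
  open ≤-Reasoning
  P = 2 ^ weight h
  G = smallCount (weight h) (evens h)
  distrib : ∀ p a b → 2 * p * (a + b) ≡ 2 * (p * a + p * b)
  distrib = solve-∀
smallCount≤points (false ∷ h) e 0 _   =
  subst (λ g → 2 ^ weight h * g ≤ length (points (false ∷ h) e))
    (trans (smallCount-zero (weight h) (evens h)) (sym (smallCount-zero (weight h) (suc (evens h)))))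
    (points-false-≥ h e (smallCount≤points h e 0 z≤n))
smallCount≤points (false ∷ h) e (suc r) 4r≤e with budget-split 1 4r≤e
... | e′ , refl , 4r≤e′ = begin
  P * smallCount k (suc m) (suc r)     ≡⟨ cong (P *_) (smallCount-suc k m r) ⟩
  P * (G (suc r) + 2 * G r)            ≡⟨ distrib P (G (suc r)) (G r) ⟩
  P * G (suc r) + 2 * (P * G r)        ≤⟨ points-false-≥-4 h e′ (smallCount≤points h (4 + e′) (suc r) 4r≤e)
                                                               (smallCount≤points h e′ r 4r≤e′) ⟩
  length (points (false ∷ h) (4 + e′)) ∎
  where
  open ≤-Reasoning
  k = weight h
  m = evens h
  P = 2 ^ k
  G = smallCount k m
  distrib : ∀ p a b → p * (a + 2 * b) ≡ p * a + 2 * (p * b)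
  distrib = solve-∀

points-true-≡ : ∀ {n} (h : Vec Bool n) e → candidates true e ≡ + 1 ∷ -[1+ 0 ] ∷ [] →
                length (points (true ∷ h) e) ≡ 2 * length (points h e)
points-true-≡ h e only±1 = trans (length-points-∷ true h e)
  (cong (λ cs → sum (map (λ c → length (points h (e ∸ excess true c))) cs)) only±1)

points-replicate-true : ∀ e → candidates true e ≡ + 1 ∷ -[1+ 0 ] ∷ [] → ∀ k {m} (h : Vec Bool m) →
                        length (points (replicate k true Vec.++ h) e) ≡ 2 ^ k * length (points h e)
points-replicate-true e only±1 zero    h = sym (*-identityˡ _)
points-replicate-true e only±1 (suc k) h = begin
  length (points (true ∷ h′) e)       ≡⟨ points-true-≡ h′ e only±1 ⟩
  2 * length (points h′ e)            ≡⟨ cong (2 *_) (points-replicate-true e only±1 k h) ⟩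
  2 * (2 ^ k * length (points h e))   ≡⟨ *-assoc 2 (2 ^ k) _ ⟨
  2 ^ suc k * length (points h e)     ∎
  where
  open ≡-Reasoning
  h′ = replicate k true Vec.++ h

points-replicate-true-10 : ∀ k {m} (h : Vec Bool m) → length (points (replicate k true Vec.++ h) 10) ≡
                           2 ^ k * (length (points h 10) + k * length (points h 2))
points-replicate-true-10 zero    h = sym (trans (*-identityˡ _) (+-identityʳ _))
points-replicate-true-10 (suc k) h = begin
  length (points (true ∷ h′) 10)
    ≡⟨ length-points-∷ true h′ 10 ⟩
  ℓ₁₀ + (ℓ₁₀ + (ℓ₂ + (ℓ₂ + 0)))
    ≡⟨ cong₂ (λ u v → u + (u + (v + (v + 0)))) (points-replicate-true-10 k h) (points-replicate-true 2 refl k h) ⟩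
  P * (a + k * b) + (P * (a + k * b) + (P * b + (P * b + 0)))
    ≡⟨ collect P a b k ⟩
  2 * P * (a + suc k * b)
    ∎
  where
  open ≡-Reasoning
  h′ = replicate k true Vec.++ h
  ℓ₁₀ = length (points h′ 10)
  ℓ₂ = length (points h′ 2)
  P = 2 ^ k
  a = length (points h 10)
  b = length (points h 2)
  collect : ∀ P a b k →
            P * (a + k * b) + (P * (a + k * b) + (P * b + (P * b + 0))) ≡ 2 * P * (a + suc k * b)
  collect = solve-∀

witness : ∀ k m → Vec Bool (k + m)
witness k m = replicate k true Vec.++ replicate m false

weight-witness : ∀ k m → weight (witness k m) ≡ k
weight-witness zero    zero    = refl
weight-witness zero    (suc m) = weight-witness zero m
weight-witness (suc k) m       = cong suc (weight-witness k m)

size-witness : ∀ k m → size (witness k m) ≡ length (points (witness k m) m)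
size-witness k m = cong (λ e → length (points (witness k m) e))
  (trans (cong (k + m ∸_) (weight-witness k m)) (m+n∸m≡n k m))

size-witness-±1 : ∀ k m → candidates true m ≡ + 1 ∷ -[1+ 0 ] ∷ [] →
                  size (witness k m) ≡ 2 ^ k * length (points (replicate m false) m)
size-witness-±1 k m only±1 =
  trans (size-witness k m) (points-replicate-true m only±1 k (replicate m false))

size-witness-10 : ∀ k → size (witness k 10) ≡ 2 ^ k * (201 + k * 1)
size-witness-10 k = trans (size-witness k 10) (points-replicate-true-10 k (replicate 10 false))

even-or-odd : ∀ m → (∃ λ i → m ≡ i * 2) ⊎ (∃ λ i → m ≡ 1 + i * 2)
even-or-odd 0             = inj₁ (0 , refl)
even-or-odd 1             = inj₂ (0 , refl)
even-or-odd (suc (suc m)) with even-or-odd m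
... | inj₁ (i , refl) = inj₁ (suc i , refl)
... | inj₂ (i , refl) = inj₂ (suc i , refl)

[1+n]%2≢n%2 : ∀ n → suc n % 2 ≢ n % 2
[1+n]%2≢n%2 zero          ()
[1+n]%2≢n%2 (suc zero)    ()
[1+n]%2≢n%2 (suc (suc n)) = [1+n]%2≢n%2 n

[k+1+i*2]%2≢k%2 : ∀ k i → (k + (1 + i * 2)) % 2 ≢ k % 2
[k+1+i*2]%2≢k%2 k i eq = [1+n]%2≢n%2 k (begin
  suc k % 2              ≡⟨ [m+kn]%n≡m%n (suc k) i 2 ⟨
  (suc k + i * 2) % 2    ≡⟨ cong (_% 2) (+-suc k (i * 2)) ⟨
  (k + (1 + i * 2)) % 2  ≡⟨ eq ⟩
  k % 2                  ∎)
  where open ≡-Reasoning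

[weight+evens]%2≡d%2 : ∀ {d} (h : Vec Bool d) {s} → evens h ≡ s → (weight h + s) % 2 ≡ d % 2
[weight+evens]%2≡d%2 h refl = cong (_% 2) (weight+evens h)

evens-even : ∀ {d} (h : Vec Bool d) → weight h % 2 ≡ d % 2 → ∃ λ i → evens h ≡ i * 2
evens-even h parity with even-or-odd (evens h)
... | inj₁ even    = even
... | inj₂ (i , eq) =
  ⊥-elim ([k+1+i*2]%2≢k%2 (weight h) i (trans ([weight+evens]%2≡d%2 h eq) (sym parity)))

evens-odd : ∀ {d} (h : Vec Bool d) → weight h % 2 ≢ d % 2 → ∃ λ i → evens h ≡ 1 + i * 2
evens-odd h parity with even-or-odd (evens h)
... | inj₂ odd      = odd
... | inj₁ (i , eq) =
  ⊥-elim (parity (trans (sym ([m+kn]%n≡m%n (weight h) i 2)) ([weight+evens]%2≡d%2 h eq)))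

rescale : ∀ c a k m g → c * 2 ^ m ≤ 2 ^ a * g → a ≤ k + m → c * 2 ^ (k + m ∸ a) ≤ 2 ^ k * g
rescale c a k m g bound a≤k+m = *-cancelˡ-≤ (2 ^ a) {{m^n≢0 2 a}} (begin
  2 ^ a * (c * 2 ^ s)     ≡⟨ x∙yz≈y∙xz (2 ^ a) c (2 ^ s) ⟩
  c * (2 ^ a * 2 ^ s)     ≡⟨ cong (c *_) (^-distribˡ-+-* 2 a s) ⟨
  c * 2 ^ (a + s)         ≡⟨ cong (λ e → c * 2 ^ e) (m+[n∸m]≡n a≤k+m) ⟩
  c * 2 ^ (k + m)         ≡⟨ cong (c *_) (^-distribˡ-+-* 2 k m) ⟩
  c * (2 ^ k * 2 ^ m)     ≡⟨ x∙yz≈y∙xz c (2 ^ k) (2 ^ m) ⟩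
  2 ^ k * (c * 2 ^ m)     ≤⟨ *-monoʳ-≤ (2 ^ k) bound ⟩
  2 ^ k * (2 ^ a * g)     ≡⟨ x∙yz≈y∙xz (2 ^ k) (2 ^ a) g ⟩
  2 ^ a * (2 ^ k * g)     ∎)
  where
  open ≤-Reasoning
  s = k + m ∸ a

dominates⇒≤size : ∀ {d} c a (h : Vec Bool d) → a ≤ d →
                  Dominates c a (evens h) (smallCount (weight h) (evens h)) → c * 2 ^ (d ∸ a) ≤ size h
dominates⇒≤size {d} c a h a≤d (dominates r 4r≤m bound) = begin
  c * 2 ^ (d ∸ a)              ≡⟨ cong (λ n → c * 2 ^ (n ∸ a)) (weight+evens h) ⟨
  c * 2 ^ (k + m ∸ a)          ≤⟨ rescale c a k m _ bound (subst (a ≤_) (sym (weight+evens h)) a≤d) ⟩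
  2 ^ k * smallCount k m r     ≤⟨ smallCount≤points h m r 4r≤m ⟩
  length (points h m)          ≡⟨ cong (λ e → length (points h e)) budget ⟨
  size h                       ∎
  where
  open ≤-Reasoning
  k = weight h
  m = evens h
  budget : d ∸ weight h ≡ evens h
  budget = trans (cong (_∸ weight h) (sym (weight+evens h))) (m+n∸m≡n (weight h) (evens h))

size-lower-bound : ∀ {d} c a (shape : ℕ → ℕ) → a ≤ d →
                   (∀ k i → k + shape i ≡ d → Dominates c a (shape i) (smallCount k (shape i))) →
                   (h : Vec Bool d) → (∃ λ i → evens h ≡ shape i) → c * 2 ^ (d ∸ a) ≤ size h
size-lower-bound c a shape a≤d bounds h (i , eq) =
  dominates⇒≤size c a h a≤d (subst (λ m → Dominates c a m (smallCount (weight h) m)) (sym eq)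
    (bounds (weight h) i (trans (cong (λ s → weight h + s) (sym eq)) (weight+evens h))))

2^k*c≡c*2^[k+m∸m] : ∀ k m c → 2 ^ k * c ≡ c * 2 ^ (k + m ∸ m)
2^k*c≡c*2^[k+m∸m] k m c = trans (*-comm (2 ^ k) c) (cong (λ e → c * 2 ^ e) (sym (m+n∸n≡m k m)))

isF0-at : ∀ k i c → size (witness k (i * 2)) ≡ 2 ^ k * c →
          (∀ k′ i′ → k′ + i′ * 2 ≡ k + i * 2 →
             Dominates c (i * 2) (i′ * 2) (smallCount k′ (i′ * 2))) →
          IsF0 (k + i * 2) (c * 2 ^ (k + i * 2 ∸ i * 2))
isF0-at k i c size≡ bounds =
  minimalCard-intro (witness k (i * 2)) witness-parity (trans size≡ (2^k*c≡c*2^[k+m∸m] k (i * 2) c))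
    (λ h p → size-lower-bound c (i * 2) (_* 2) (m≤n+m (i * 2) k) bounds h (evens-even h p))
  where
  witness-parity : weight (witness k (i * 2)) % 2 ≡ (k + i * 2) % 2
  witness-parity = trans (cong (_% 2) (weight-witness k (i * 2))) (sym ([m+kn]%n≡m%n k i 2))

isF1-at : ∀ k i c → size (witness k (1 + i * 2)) ≡ 2 ^ k * c →
          (∀ k′ i′ → k′ + (1 + i′ * 2) ≡ k + (1 + i * 2) →
             Dominates c (1 + i * 2) (1 + i′ * 2) (smallCount k′ (1 + i′ * 2))) →
          IsF1 (k + (1 + i * 2)) (c * 2 ^ (k + (1 + i * 2) ∸ (1 + i * 2)))
isF1-at k i c size≡ bounds =
  minimalCard-intro (witness k m) witness-parity (trans size≡ (2^k*c≡c*2^[k+m∸m] k m c))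
    (λ h p → size-lower-bound c m (λ i → 1 + i * 2) (m≤n+m m k) bounds h (evens-odd h p))
  where
  m = 1 + i * 2
  witness-parity : weight (witness k (1 + i * 2)) % 2 ≢ (k + (1 + i * 2)) % 2
  witness-parity eq = [k+1+i*2]%2≢k%2 k i (trans (sym eq) (cong (_% 2) (weight-witness k (1 + i * 2))))

summand≤ : ∀ {k s d D} → k + s ≡ d → d ≤ D → s ≤ D
summand≤ {k} {s} refl d≤D = ≤-trans (m≤n+m s k) d≤D

from-sparse : ∀ {c a m} k → Dominates c a m (sparse m) → Dominates c a m (smallCount k m)
from-sparse k = Dominates-mono (sparse≤smallCount k _)

f₀-1-bounds : ∀ k i → i * 2 ≤ 1 → Dominates 1 0 (i * 2) (smallCount k (i * 2))
f₀-1-bounds k 0       _           = from-sparse k (by-computation _)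
f₀-1-bounds k (suc i) (s≤s ())

f₀-2-5-bounds : ∀ k i → i * 2 ≤ 5 → Dominates 1 2 (i * 2) (smallCount k (i * 2))
f₀-2-5-bounds k 0 _ = from-sparse k (by-computation _)
f₀-2-5-bounds k 1 _ = from-sparse k (by-computation _)
f₀-2-5-bounds k 2 _ = from-sparse k (by-computation _)
f₀-2-5-bounds k (suc (suc (suc i))) (s≤s (s≤s (s≤s (s≤s (s≤s ())))))

f₀-13-bounds : ∀ k i → (6 ≤ k + i * 2 × k + i * 2 ≤ 9) ⊎ 17 ≤ k + i * 2 →
               Dominates 13 6 (i * 2) (smallCount k (i * 2))
f₀-13-bounds k 0 _ = from-sparse k (by-computation _)
f₀-13-bounds k 1 _ = from-sparse k (by-computation _)
f₀-13-bounds k 2 _ = from-sparse k (by-computation _)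
f₀-13-bounds k 3 _ = from-sparse k (by-computation _)
f₀-13-bounds k 4 _ = from-sparse k (by-computation _)
-- For m = 10 and 14 the even coordinates alone fall short; points with an odd coordinate ±3
-- make up the difference once d ≥ 17.
f₀-13-bounds k 5 (inj₁ (_ , k+10≤9)) = ⊥-elim (<-irrefl refl (m+n≤o⇒n≤o k k+10≤9))
f₀-13-bounds k 5 (inj₂ 17≤k+10) = dominates 2 (m≤m+n 8 2) (begin
  2 ^ 6 * (7 + 201)            ≤⟨ *-monoʳ-≤ (2 ^ 6) (+-monoˡ-≤ 201 (+-cancelʳ-≤ 10 7 k 17≤k+10)) ⟩
  2 ^ 6 * (k + 201)            ≡⟨ cong (2 ^ 6 *_) (smallCount-10-2 k) ⟨
  2 ^ 6 * smallCount k 10 2    ∎)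
  where open ≤-Reasoning
f₀-13-bounds k 6 _ = from-sparse k (by-computation _)
f₀-13-bounds k 7 (inj₁ (_ , k+14≤9)) =
  ⊥-elim (<-irrefl refl (≤-trans (m≤m+n 10 4) (m+n≤o⇒n≤o k k+14≤9)))
f₀-13-bounds k 7 (inj₂ 17≤k+14) = dominates 3 (m≤m+n 12 2) (begin
  13 * 2 ^ 14                  ≤⟨ ≤ᵇ⇒≤ (13 * 2 ^ 14) (2 ^ 6 * (29 * 1 + 3305)) _ ⟩
  2 ^ 6 * (29 * 1 + 3305)      ≤⟨ *-monoʳ-≤ (2 ^ 6) (+-monoˡ-≤ 3305 (*-monoʳ-≤ 29 1≤k)) ⟩
  2 ^ 6 * (29 * k + 3305)      ≤⟨ *-monoʳ-≤ (2 ^ 6) (smallCount-14-3 k) ⟩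
  2 ^ 6 * smallCount k 14 3    ∎)
  where
  open ≤-Reasoning
  1≤k : 1 ≤ k
  1≤k = ≤-trans (m≤m+n 1 2) (+-cancelʳ-≤ 14 3 k 17≤k+14)
f₀-13-bounds k 8 _ = from-sparse k (by-computation _)
f₀-13-bounds k (suc (suc (suc (suc (suc (suc (suc (suc (suc i))))))))) _ =
  from-sparse k (dominates-13-6-tail i)

from-sparse-208 : ∀ k i → k + i * 2 ≤ 17 → Dominates 208 10 (i * 2) (sparse (i * 2)) →
                  Dominates (k + i * 2 + 191) 10 (i * 2) (smallCount k (i * 2))
from-sparse-208 k i d≤17 = Dominates-weaken (+-monoˡ-≤ 191 d≤17) ∘′ from-sparse k

f₀-10-17-bounds : ∀ k i → k + i * 2 ≤ 17 →
                  Dominates (k + i * 2 + 191) 10 (i * 2) (smallCount k (i * 2))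
f₀-10-17-bounds k 0 d≤17 = from-sparse-208 k 0 d≤17 (by-computation _)
f₀-10-17-bounds k 1 d≤17 = from-sparse-208 k 1 d≤17 (by-computation _)
f₀-10-17-bounds k 2 d≤17 = from-sparse-208 k 2 d≤17 (by-computation _)
f₀-10-17-bounds k 3 d≤17 = from-sparse-208 k 3 d≤17 (by-computation _)
f₀-10-17-bounds k 4 d≤17 = from-sparse-208 k 4 d≤17 (by-computation _)
f₀-10-17-bounds k 5 d≤17 = dominates 2 (m≤m+n 8 2) (≤-reflexive (begin
  (k + 10 + 191) * 2 ^ 10        ≡⟨ reorder k (2 ^ 10) ⟩
  2 ^ 10 * (k + 201)             ≡⟨ cong (2 ^ 10 *_) (smallCount-10-2 k) ⟨
  2 ^ 10 * smallCount k 10 2     ∎))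
  where
  open ≡-Reasoning
  reorder : ∀ k x → (k + 10 + 191) * x ≡ x * (k + 201)
  reorder = solve-∀
f₀-10-17-bounds k 6 d≤17 = from-sparse-208 k 6 d≤17 (by-computation _)
f₀-10-17-bounds k 7 d≤17 = dominates 3 (m≤m+n 12 2) (begin
  (k + 14 + 191) * 2 ^ 14        ≡⟨ reorder k (2 ^ 10) ⟩
  2 ^ 10 * (16 * k + 3280)
    ≤⟨ *-monoʳ-≤ (2 ^ 10) (+-mono-≤ (*-monoˡ-≤ k (m≤m+n 16 13)) (m≤m+n 3280 25)) ⟩
  2 ^ 10 * (29 * k + 3305)       ≤⟨ *-monoʳ-≤ (2 ^ 10) (smallCount-14-3 k) ⟩
  2 ^ 10 * smallCount k 14 3     ∎)
  where
  open ≤-Reasoning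
  reorder : ∀ k x → (k + 14 + 191) * (16 * x) ≡ x * (16 * k + 3280)
  reorder = solve-∀
f₀-10-17-bounds k 8 d≤17 = from-sparse-208 k 8 d≤17 (by-computation _)
f₀-10-17-bounds k (suc (suc (suc (suc (suc (suc (suc (suc (suc i))))))))) d≤17 =
  ⊥-elim (<-irrefl refl (≤-trans (m≤m+n 18 (i * 2)) (m+n≤o⇒n≤o k d≤17)))

f₁-1-2-bounds : ∀ k i → 1 + i * 2 ≤ 2 → Dominates 1 1 (1 + i * 2) (smallCount k (1 + i * 2))
f₁-1-2-bounds k 0       _ = from-sparse k (by-computation _)
f₁-1-2-bounds k (suc i) (s≤s (s≤s ()))

f₁-3-6-bounds : ∀ k i → 1 + i * 2 ≤ 6 → Dominates 1 3 (1 + i * 2) (smallCount k (1 + i * 2))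
f₁-3-6-bounds k 0 _ = from-sparse k (by-computation _)
f₁-3-6-bounds k 1 _ = from-sparse k (by-computation _)
f₁-3-6-bounds k 2 _ = from-sparse k (by-computation _)
f₁-3-6-bounds k (suc (suc (suc i))) (s≤s (s≤s (s≤s (s≤s (s≤s (s≤s ()))))))

f₁-15-bounds : ∀ k i → Dominates 15 7 (1 + i * 2) (smallCount k (1 + i * 2))
f₁-15-bounds k 0 = from-sparse k (by-computation _)
f₁-15-bounds k 1 = from-sparse k (by-computation _)
f₁-15-bounds k 2 = from-sparse k (by-computation _)
f₁-15-bounds k 3 = from-sparse k (by-computation _)
f₁-15-bounds k 4 = from-sparse k (by-computation _)
f₁-15-bounds k (suc (suc (suc (suc (suc i))))) = from-sparse k (dominates-15-7-tail i)

f₀-1 : IsF0 1 2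
f₀-1 = isF0-at 1 0 1 refl (λ k i eq → f₀-1-bounds k i (summand≤ eq ≤-refl))

f₀-2-5 : ∀ d → 2 ≤ d → d ≤ 5 → IsF0 d (2 ^ (d ∸ 2))
f₀-2-5 d 2≤d = offset-elim (λ d → d ≤ 5 → IsF0 d (2 ^ (d ∸ 2))) 2≤d λ k d≤5 →
  subst (IsF0 (k + 2)) (*-identityˡ _)
    (isF0-at k 1 1 (size-witness-±1 k 2 refl) (λ k′ i eq → f₀-2-5-bounds k′ i (summand≤ eq d≤5)))

f₀-13 : ∀ d → (6 ≤ d × d ≤ 9) ⊎ 17 ≤ d → IsF0 d (13 * 2 ^ (d ∸ 6))
f₀-13 d range = offset-elim (λ d → Range d → IsF0 d (13 * 2 ^ (d ∸ 6))) (6≤d range)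
  (λ k range → isF0-at k 3 13 (size-witness-±1 k 6 refl)
    (λ k′ i eq → f₀-13-bounds k′ i (subst Range (sym eq) range)))
  range
  where
  Range : ℕ → Set
  Range d = (6 ≤ d × d ≤ 9) ⊎ 17 ≤ d
  6≤d : Range d → 6 ≤ d
  6≤d (inj₁ (6≤d , _)) = 6≤d
  6≤d (inj₂ 17≤d)      = ≤-trans (m≤m+n 6 11) 17≤d

f₀-10-17 : ∀ d → 10 ≤ d → d ≤ 17 → IsF0 d ((191 + d) * 2 ^ (d ∸ 10))
f₀-10-17 d 10≤d =
  offset-elim (λ d → d ≤ 17 → IsF0 d ((191 + d) * 2 ^ (d ∸ 10))) 10≤d λ k d≤17 →
  subst (λ c → IsF0 (k + 10) (c * 2 ^ (k + 10 ∸ 10))) (+-comm (k + 10) 191)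
    (isF0-at k 5 (k + 10 + 191) (trans (size-witness-10 k) (cong (2 ^ k *_) (count k)))
      (λ k′ i eq → subst (λ d → Dominates (d + 191) 10 (i * 2) (smallCount k′ (i * 2))) eq
        (f₀-10-17-bounds k′ i (subst (_≤ 17) (sym eq) d≤17))))
  where
  count : ∀ k → 201 + k * 1 ≡ k + 10 + 191
  count = solve-∀

f₁-1-2 : ∀ d → 1 ≤ d → d ≤ 2 → IsF1 d (2 ^ (d ∸ 1))
f₁-1-2 d 1≤d = offset-elim (λ d → d ≤ 2 → IsF1 d (2 ^ (d ∸ 1))) 1≤d λ k d≤2 →
  subst (IsF1 (k + 1)) (*-identityˡ _)
    (isF1-at k 0 1 (size-witness-±1 k 1 refl) (λ k′ i eq → f₁-1-2-bounds k′ i (summand≤ eq d≤2)))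

f₁-3-6 : ∀ d → 3 ≤ d → d ≤ 6 → IsF1 d (2 ^ (d ∸ 3))
f₁-3-6 d 3≤d = offset-elim (λ d → d ≤ 6 → IsF1 d (2 ^ (d ∸ 3))) 3≤d λ k d≤6 →
  subst (IsF1 (k + 3)) (*-identityˡ _)
    (isF1-at k 1 1 (size-witness-±1 k 3 refl) (λ k′ i eq → f₁-3-6-bounds k′ i (summand≤ eq d≤6)))

f₁-15 : ∀ d → 7 ≤ d → IsF1 d (15 * 2 ^ (d ∸ 7))
f₁-15 d 7≤d = offset-elim (λ d → IsF1 d (15 * 2 ^ (d ∸ 7))) 7≤d λ k →
  isF1-at k 3 15 (size-witness-±1 k 7 refl) (λ k′ i _ → f₁-15-bounds k′ i)

propositionB1 : ∀ (d : ℕ) → 1 ≤ d →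
    ((d ≡ 1 → IsF0 d (2 ^ d))
    × (2 ≤ d → d ≤ 5 → IsF0 d (2 ^ (d ∸ 2)))
    × ((6 ≤ d × d ≤ 9) ⊎ 17 ≤ d → IsF0 d (13 * 2 ^ (d ∸ 6)))
    × (10 ≤ d → d ≤ 17 → IsF0 d ((191 + d) * 2 ^ (d ∸ 10))))
    × ((d ≤ 2 → IsF1 d (2 ^ (d ∸ 1)))
    × (3 ≤ d → d ≤ 6 → IsF1 d (2 ^ (d ∸ 3)))
    × (7 ≤ d → IsF1 d (15 * 2 ^ (d ∸ 7))))
propositionB1 d 1≤d =
  ((λ { refl → f₀-1 }) , f₀-2-5 d , f₀-13 d , f₀-10-17 d) ,
  (f₁-1-2 d 1≤d , f₁-3-6 d , f₁-15 d)
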